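{- Let $\Gamma$ be a proper LDDG with parameters $(v,k,\lambda_1,\lambda_2,m,n)$. Then $0 \leq \lambda_1 \leq k$. Moreover, if $\lambda_1 = k$, then $\Gamma$ is either (i) obtained from a symmetric design by the construction described in the context, or (ii) a disjoint union of copies of $\widetilde{K_n}$ and copies of $K_{n,n}$.
   Context: Graphs here are finite, undirected, without multiple edges, but loops are allowed: a vertex may be adjacent to itself. For a vertex $x$, $\Gamma(x)$ is the set of vertices adjacent to $x$ (containing $x$ iff $x$ has a loop), and the degree of $x$ is $|\Gamma(x)|$ (a loop contributes exactly 1). Common neighbours of $x,y$ are the elements of $\Gamma(x)\cap\Gamma(y)$. A $k$-regular graph on $v$ vertices is an LDDG with parameters $(v,k,\lambda_1,\lambda_2,m,n)$ if its vertex set can be partitioned into $m$ classes of size $n$ such that any two distinct vertices of the same class have exactly $\lambda_1$ common neighbours and any two vertices of different classes have exactly $\lambda_2$ common neighbours. It is proper if $m,n\geq 2$ and $\lambda_1\neq\lambda_2$. For a loopless graph $G$, $\widetilde{G}$ denotes the graph obtained by adding a loop at every vertex; $K_n$ is the complete graph and $K_{n,n}$ the complete bipartite graph. Symmetric design construction: let $\mathcal{D}$ be a symmetric design on the point set $\{1,\ldots,m\}$, $m\geq 3$, with $m$ blocks each of size $l_1$, any two distinct blocks meeting in exactly $l_2$ points, where $0<l_2<l_1<m$. Let $\theta$ be a bijection from $\{1,\ldots,m\}$ to the set of blocks such that $i \in j^\theta$ iff $j\in i^\theta$. Let $X_1,\ldots,X_m$ be pairwise disjoint sets of size $n\geq 2$,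 and on $X_1\cup\cdots\cup X_m$ declare possibly equal vertices $u\in X_i$, $v\in X_j$ adjacent iff $j\in i^\theta$. (This gives a proper LDDG with parameters $(mn,l_1n,l_1n,l_2n,m,n)$.) -}

module Defs where

open import Data.Nat using (ℕ; zero; suc; _+_; _≤_; _<_)
open import Data.Bool using (Bool; true; false; _∧_; if_then_else_)
open import Data.Fin using (Fin; zero; suc; _≟_)
open import Data.Product using (Σ; _×_; _,_)
open import Data.Sum using (_⊎_; inj₁; inj₂)
open import Relation.Binary.PropositionalEquality using (_≡_; _≢_)
open import Relation.Nullary.Decidable using (⌊_⌋)
open import Function.Bundles using (_⤖_; Bijection)

count : ∀ {n} → (Fin n → Bool) → ℕ
count {zero}  P = 0
count {suc n} P = (if P zero then 1 else 0) + count {n} (λ i → P (suc i))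

-- A finite undirected graph on vertex set Fin v, loops allowed, no multi-edges:
-- a symmetric Boolean adjacency relation (adj x x = true means a loop at x).
record Graph (v : ℕ) : Set where
  field
    adj : Fin v → Fin v → Bool
    sym : ∀ x y → adj x y ≡ adj y x

open Graph public

-- degree |Γ(x)| (a loop contributes exactly 1)
degree : ∀ {v} → Graph v → Fin v → ℕ
degree G x = count (adj G x)

common : ∀ {v} → Graph v → Fin v → Fin v → ℕ
common G x y = count (λ z → adj G x z ∧ adj G y z)

record IsLDDG {v : ℕ} (G : Graph v) (k λ₁ λ₂ m n : ℕ) : Set where
  field
    regular   : ∀ x → degree G x ≡ k
    cls       : Fin v → Fin m
    clsSize   : ∀ (c : Fin m) → count (λ x → ⌊ cls x ≟ c ⌋) ≡ n
    sameClass : ∀ x y → x ≢ y → cls x ≡ cls y → common G x y ≡ λ₁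
    diffClass : ∀ x y → cls x ≢ cls y → common G x y ≡ λ₂

IsProper : (λ₁ λ₂ m n : ℕ) → Set
IsProper λ₁ λ₂ m n = 2 ≤ m × 2 ≤ n × λ₁ ≢ λ₂

IsoTo : ∀ {v} → Graph v → (X : Set) → (X → X → Bool) → Set
IsoTo {v} G X a = Σ (X ⤖ Fin v) λ f →
  ∀ x y → adj G (Bijection.to f x) (Bijection.to f y) ≡ a x y

-- Symmetric design on points Fin m with m blocks B : Fin m → (Fin m → Bool)
-- (B b i = true iff point i lies in block b), block size l₁,
-- two distinct blocks meeting in exactly l₂ points.
IsSymmetricDesign : (m l₁ l₂ : ℕ) → (Fin m → Fin m → Bool) → Set
IsSymmetricDesign m l₁ l₂ B =
  (∀ b → count (B b) ≡ l₁) ×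
  (∀ b c → b ≢ c → count (λ i → B b i ∧ B c i) ≡ l₂)

-- the construction graph on X₁ ∪ … ∪ Xₘ, Xᵢ = {i} × Fin n:
-- (i,a) ~ (j,b) iff j ∈ i^θ
designGraphAdj : ∀ {m} (n : ℕ) → (Fin m → Fin m → Bool) → (Fin m → Fin m) →
  (Fin m × Fin n) → (Fin m × Fin n) → Bool
designGraphAdj n B θ (i , _) (j , _) = B (θ i) j

FromSymmetricDesign : ∀ {v} → Graph v → (m n : ℕ) → Set
FromSymmetricDesign G m n =
  Σ ℕ λ l₁ → Σ ℕ λ l₂ → Σ (Fin m → Fin m → Bool) λ B →
  Σ (Fin m ⤖ Fin m) λ θ →
    3 ≤ m × 0 < l₂ × l₂ < l₁ × l₁ < m × 2 ≤ n ×
    IsSymmetricDesign m l₁ l₂ B ×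
    (∀ i j → B (Bijection.to θ j) i ≡ B (Bijection.to θ i) j) ×
    IsoTo G (Fin m × Fin n) (designGraphAdj n B (Bijection.to θ))

-- disjoint union of a copies of K̃ₙ and b copies of K_{n,n}
DUVertex : (a b n : ℕ) → Set
DUVertex a b n = (Fin a × Fin n) ⊎ (Fin b × (Fin n ⊎ Fin n))

duAdj : ∀ {a b n} → DUVertex a b n → DUVertex a b n → Bool
duAdj (inj₁ (c , _)) (inj₁ (d , _)) = ⌊ c ≟ d ⌋
duAdj (inj₂ (c , inj₁ _)) (inj₂ (d , inj₂ _)) = ⌊ c ≟ d ⌋
duAdj (inj₂ (c , inj₂ _)) (inj₂ (d , inj₁ _)) = ⌊ c ≟ d ⌋
duAdj _ _ = false

DisjointUnionKtildeKnn : ∀ {v} → Graph v → (n : ℕ) → Set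
DisjointUnionKtildeKnn G n =
  Σ ℕ λ a → Σ ℕ λ b → IsoTo G (DUVertex a b n) duAdj

{-# OPTIONS --safe #-}

-- Common neighbours of x and y are neighbours of x, so λ₁ ≤ k. If λ₁ = k, any two
-- vertices of a class have the same neighbourhood, so Γ is the blow-up (every vertex
-- replaced by n copies) of a symmetric 0/1 matrix A on the m classes. Counting in the
-- blow-up, each row of A has l₁ = k/n ones and two distinct rows share l₂ = λ₂/n ones,
-- where l₁ ≠ l₂ as λ₁ ≠ λ₂. If l₂ > 0, the rows of A are the blocks of a symmetric
-- design and Γ is its construction with θ = id. If l₂ = 0, the nonempty rows are
-- pairwise disjoint, so A is the matrix of an involution σ of the classes: fixed points
-- of σ give copies of K̃ₙ, two-element orbits copies of K_{n,n}.
module Submission where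

open import Defs hiding (sym)
open import Data.Bool using (Bool; true; false; _∧_; not; if_then_else_)
open import Data.Bool.Properties using (not-injective)
import Data.Fin as Fin
open import Data.Fin using (Fin; zero; suc; _≟_; _↑ˡ_; _↑ʳ_; quotient; remQuot)
open import Data.Fin.Properties
  using (suc-injective; splitAt-↑ˡ; splitAt-↑ʳ; *↔×; _<?_; <-irrefl; <-asym; <-cmp)
open import Data.Nat using (ℕ; zero; suc; _+_; _*_; _≤_; _<_; z≤n; s≤s)
open import Data.Nat.Properties
  using ( +-assoc; +-identityʳ; +-cancelˡ-≡; *-zeroʳ; *-identityʳ; *-distribˡ-+; *-cancelˡ-≡
        ; m≤m+n; ≤-trans; ≤∧≢⇒<; n≢0⇒n>0; +-0-commutativeMonoid)
  renaming (_≟_ to _≟ℕ_)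
open import Data.Product as Product using (Σ; _×_; _,_; proj₁; proj₂; ∃; ∃₂; <_,_>)
open import Data.Product.Function.NonDependent.Propositional using (_×-⤖_)
open import Data.Sum using (_⊎_; inj₁; inj₂; map₂; swap)
open import Data.Sum.Properties using (≡-dec)
open import Function
  using ( _∘_; id; _↔_; _⤖_; _⇔_; Inverse; Bijection; Injective; StrictlySurjective
        ; mk↔ₛ′; mk⇔; mk⤖)
open import Function.Consequences.Propositional using (strictlySurjective⇒surjective)
open import Function.Construct.Composition using (_↔-∘_; _⤖-∘_)
open import Function.Construct.Identity using (⤖-id)
open import Function.Properties.Bijection using (⤖⇒↔)
open import Function.Properties.Inverse using (↔⇒⤖)
open import Relation.Binary.Definitions using (DecidableEquality; tri<; tri≈; tri>)
open import Relation.Binary.PropositionalEquality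
open import Relation.Nullary using (Dec; yes; no; does; contradiction)
open import Relation.Nullary.Decidable using (⌊_⌋; does-⇔; isYes≗does)
import Algebra.Properties.CommutativeMonoid.Sum as Sum

open Sum +-0-commutativeMonoid using (sum; sum-cong-≗; sum-permute; ∑-distrib-+)

open ≡-Reasoning

indicator : Bool → ℕ
indicator b = if b then 1 else 0

private
  variable
    m n v : ℕ

toWitness≡ : ∀ {a} {A : Set a} (a? : Dec A) → ⌊ a? ⌋ ≡ true → A
toWitness≡ (yes a) _ = a

fromWitness≡ : ∀ {a} {A : Set a} (a? : Dec A) → A → ⌊ a? ⌋ ≡ true
fromWitness≡ (yes _) _ = refl
fromWitness≡ (no ¬a) a = contradiction a ¬a

⇔true⇒≡ : ∀ {x y : Bool} → (x ≡ true → y ≡ true) → (y ≡ true → x ≡ true) → x ≡ y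
⇔true⇒≡ {false} {false} _   _   = refl
⇔true⇒≡ {false} {true}  _   y⇒x = y⇒x refl
⇔true⇒≡ {true}          x⇒y _   = sym (x⇒y refl)

count-cong : {P Q : Fin n → Bool} → (∀ i → P i ≡ Q i) → count P ≡ count Q
count-cong {zero}  P≗Q = refl
count-cong {suc n} P≗Q = cong₂ _+_ (cong indicator (P≗Q zero)) (count-cong (P≗Q ∘ suc))

count≡sum : (P : Fin n → Bool) → count P ≡ sum (indicator ∘ P)
count≡sum {zero}  P = refl
count≡sum {suc n} P = cong (indicator (P zero) +_) (count≡sum (P ∘ suc))

count-↔ : (π : Fin m ↔ Fin n) (P : Fin n → Bool) → count P ≡ count (P ∘ Inverse.to π)
count-↔ π P = begin
  count P                           ≡⟨ count≡sum P ⟩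
  sum (indicator ∘ P)               ≡⟨ sum-permute (indicator ∘ P) π ⟩
  sum (indicator ∘ P ∘ Inverse.to π) ≡⟨ count≡sum (P ∘ Inverse.to π) ⟨
  count (P ∘ Inverse.to π)          ∎

count-∧-∧not : (P Q : Fin n → Bool) →
  count P ≡ count (λ i → P i ∧ Q i) + count (λ i → P i ∧ not (Q i))
count-∧-∧not P Q = begin
  count P
    ≡⟨ count≡sum P ⟩
  sum (indicator ∘ P)
    ≡⟨ sum-cong-≗ (λ i → indicator-split (P i) (Q i)) ⟩
  sum (λ i → indicator (P i ∧ Q i) + indicator (P i ∧ not (Q i)))
    ≡⟨ ∑-distrib-+ (λ i → indicator (P i ∧ Q i)) (λ i → indicator (P i ∧ not (Q i))) ⟩
  sum (λ i → indicator (P i ∧ Q i)) + sum (λ i → indicator (P i ∧ not (Q i)))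
    ≡⟨ cong₂ _+_ (count≡sum (λ i → P i ∧ Q i)) (count≡sum (λ i → P i ∧ not (Q i))) ⟨
  count (λ i → P i ∧ Q i) + count (λ i → P i ∧ not (Q i))
    ∎
  where
  indicator-split : ∀ a b → indicator a ≡ indicator (a ∧ b) + indicator (a ∧ not b)
  indicator-split false _     = refl
  indicator-split true  false = refl
  indicator-split true  true  = refl

count≡0⇒false : (P : Fin n → Bool) → count P ≡ 0 → ∀ i → P i ≡ false
count≡0⇒false {suc n} P c≡0 i with P zero in P0
count≡0⇒false {suc n} P ()  i       | true
count≡0⇒false {suc n} P c≡0 zero    | false = P0
count≡0⇒false {suc n} P c≡0 (suc i) | false = count≡0⇒false (P ∘ suc) c≡0 i

count≢0⇒∃ : (P : Fin n → Bool) → count P ≢ 0 → ∃ λ i → P i ≡ true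
count≢0⇒∃ {zero}  P c≢0 = contradiction refl c≢0
count≢0⇒∃ {suc n} P c≢0 with P zero in P0
... | true  = zero , P0
... | false = Product.map suc id (count≢0⇒∃ (P ∘ suc) c≢0)

count-const : ∀ n b → count {n} (λ _ → b) ≡ n * indicator b
count-const zero    b = refl
count-const (suc n) b = cong (indicator b +_) (count-const n b)

count-true : count {n} (λ _ → true) ≡ n
count-true {n} = trans (count-const n true) (*-identityʳ n)

count-∧≤ : (P Q : Fin n → Bool) → count (λ i → P i ∧ Q i) ≤ count P
count-∧≤ P Q = subst (count (λ i → P i ∧ Q i) ≤_) (sym (count-∧-∧not P Q)) (m≤m+n _ _)

count-≤ : (P : Fin n → Bool) → count P ≤ n
count-≤ P = subst (count P ≤_) count-true (count-∧≤ (λ _ → true) P)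

count-∧≡⇒⊆ : (P Q : Fin n → Bool) → count (λ i → P i ∧ Q i) ≡ count P →
  ∀ {i} → P i ≡ true → Q i ≡ true
count-∧≡⇒⊆ P Q eq {i} Pi = not-injective (trans (cong (_∧ not (Q i)) (sym Pi))
  (count≡0⇒false (λ j → P j ∧ not (Q j)) P∧¬Q≡0 i))
  where
  P∧¬Q≡0 : count (λ j → P j ∧ not (Q j)) ≡ 0
  P∧¬Q≡0 = +-cancelˡ-≡ (count (λ j → P j ∧ Q j)) _ 0
    (trans (trans (sym (count-∧-∧not P Q)) (sym eq)) (sym (+-identityʳ _)))

count≡n⇒true : (P : Fin n → Bool) → count P ≡ n → ∀ i → P i ≡ true
count≡n⇒true P eq i = count-∧≡⇒⊆ (λ _ → true) P (trans eq (sym count-true)) refl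

count-+ : ∀ m {n} (P : Fin (m + n) → Bool) →
  count P ≡ count (λ i → P (i ↑ˡ n)) + count (λ j → P (m ↑ʳ j))
count-+ zero    P = refl
count-+ (suc m) P = trans (cong (indicator (P zero) +_) (count-+ m (P ∘ suc)))
  (sym (+-assoc (indicator (P zero)) _ _))

quotient-↑ˡ : ∀ m {n} (i : Fin n) → quotient {suc m} n (i ↑ˡ m * n) ≡ zero
quotient-↑ˡ m {n} i rewrite splitAt-↑ˡ n i (m * n) = refl

quotient-↑ʳ : ∀ m {n} (j : Fin (m * n)) → quotient {suc m} n (n ↑ʳ j) ≡ suc (quotient n j)
quotient-↑ʳ m {n} j rewrite splitAt-↑ʳ n (m * n) j = refl

count-quotient : ∀ m {n} (P : Fin m → Bool) → count (λ i → P (quotient {m} n i)) ≡ n * count P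
count-quotient zero    {n} P = sym (*-zeroʳ n)
count-quotient (suc m) {n} P = begin
  count (λ i → P (quotient n i))
    ≡⟨ count-+ n _ ⟩
  count (λ i → P (quotient n (i ↑ˡ m * n))) + count (λ j → P (quotient n (n ↑ʳ j)))
    ≡⟨ cong₂ _+_ (count-cong {n} (λ i → cong P (quotient-↑ˡ m i)))
                 (count-cong (λ j → cong P (quotient-↑ʳ m j))) ⟩
  count {n} (λ _ → P zero) + count (λ j → P (suc (quotient n j)))
    ≡⟨ cong₂ _+_ (count-const n (P zero)) (count-quotient m (P ∘ suc)) ⟩
  n * indicator (P zero) + n * count (P ∘ suc)
    ≡⟨ *-distribˡ-+ n _ _ ⟨
  n * count P
    ∎

count-proj₁ : (Φ : (Fin m × Fin n) ↔ Fin v) (P : Fin m → Bool) →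
  count (λ x → P (proj₁ (Inverse.from Φ x))) ≡ n * count P
count-proj₁ {m} {n} Φ P = begin
  count (λ x → P (proj₁ (Inverse.from Φ x)))
    ≡⟨ count-↔ (Φ ↔-∘ *↔×) (λ x → P (proj₁ (Inverse.from Φ x))) ⟩
  count (λ i → P (proj₁ (Inverse.from Φ (Inverse.to Φ (remQuot n i)))))
    ≡⟨ count-cong (λ i → cong (P ∘ proj₁) (Inverse.strictlyInverseʳ Φ (remQuot n i))) ⟩
  count (λ i → P (quotient {m} n i))
    ≡⟨ count-quotient m P ⟩
  n * count P
    ∎

record Enumeration (P : Fin v → Bool) (k : ℕ) : Set where
  field
    enum      : Fin k → Fin v
    injective : Injective _≡_ _≡_ enum
    sound     : ∀ i → P (enum i) ≡ true
    complete  : ∀ x → P x ≡ true → ∃ λ i → enum i ≡ x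

enumerate : (P : Fin v → Bool) → Enumeration P (count P)
enumerate {zero}  P = record
  { enum = λ () ; injective = λ { {()} } ; sound = λ () ; complete = λ () }
enumerate {suc v} P = extend (P zero) refl (enumerate (P ∘ suc))
  where
  extend : ∀ {k} b → P zero ≡ b → Enumeration (P ∘ suc) k → Enumeration P (indicator b + k)
  extend true P0 E = record
    { enum = enum ; injective = injective ; sound = sound ; complete = complete }
    where
    open Enumeration E renaming
      (enum to e; injective to e-injective; sound to e-sound; complete to e-complete)
    enum : Fin (suc _) → Fin (suc v)
    enum zero    = zero
    enum (suc i) = suc (e i)
    injective : Injective _≡_ _≡_ enum
    injective {zero}  {zero}  _  = refl
    injective {zero}  {suc _} ()
    injective {suc _} {zero}  ()
    injective {suc i} {suc j} eq = cong suc (e-injective (suc-injective eq))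
    sound : ∀ i → P (enum i) ≡ true
    sound zero    = P0
    sound (suc i) = e-sound i
    complete : ∀ x → P x ≡ true → ∃ λ i → enum i ≡ x
    complete zero    _  = zero , refl
    complete (suc x) Px = Product.map suc (cong suc) (e-complete x Px)
  extend false P0 E = record
    { enum = suc ∘ e ; injective = e-injective ∘ suc-injective
    ; sound = e-sound ; complete = complete }
    where
    open Enumeration E renaming
      (enum to e; injective to e-injective; sound to e-sound; complete to e-complete)
    complete : ∀ x → P x ≡ true → ∃ λ i → suc (e i) ≡ x
    complete zero    Px = contradiction (trans (sym P0) Px) λ ()
    complete (suc x) Px = Product.map₂ (cong suc) (e-complete x Px)

fibreBijection : (f : Fin v → Fin m) → (∀ c → Enumeration (λ x → ⌊ f x ≟ c ⌋) n) →
  Σ ((Fin m × Fin n) ↔ Fin v) λ Φ → ∀ p → f (Inverse.to Φ p) ≡ proj₁ p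
fibreBijection {v} {m} {n} f E =
  ⤖⇒↔ (mk⤖ (Φ-injective , strictlySurjective⇒surjective Φ-surjective)) , f∘Φ
  where
  open Enumeration
  Φ : Fin m × Fin n → Fin v
  Φ (c , i) = enum (E c) i
  f∘Φ : ∀ p → f (Φ p) ≡ proj₁ p
  f∘Φ (c , i) = toWitness≡ (f _ ≟ c) (sound (E c) i)
  Φ-injective : Injective _≡_ _≡_ Φ
  Φ-injective {c , i} {d , j} eq
    with refl ← trans (sym (f∘Φ (c , i))) (trans (cong f eq) (f∘Φ (d , j)))
    = cong (c ,_) (injective (E c) eq)
  Φ-surjective : StrictlySurjective _≡_ Φ
  Φ-surjective x with i , eq ← complete (E (f x)) x (fromWitness≡ (f x ≟ f x) refl) =
    (f x , i) , eq

-- The points of an involution with a fixed points and b two-element orbits;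
-- the involution is map₂ swap.
Orbits : ℕ → ℕ → Set
Orbits a b = Fin a ⊎ (Fin b ⊎ Fin b)

module _ {m} (σ : Fin m → Fin m) (σ-involutive : ∀ x → σ (σ x) ≡ x) where

  private
    fixed? lower? : Fin m → Bool
    fixed? x = ⌊ σ x ≟ x ⌋
    lower? x = ⌊ x <? σ x ⌋

    module Fix = Enumeration (enumerate fixed?)
    module Low = Enumeration (enumerate lower?)

    fix-fixed : ∀ c → σ (Fix.enum c) ≡ Fix.enum c
    fix-fixed c = toWitness≡ (σ _ ≟ _) (Fix.sound c)

    low-lower : ∀ c → Low.enum c Fin.< σ (Low.enum c)
    low-lower c = toWitness≡ (_ <? σ _) (Low.sound c)

    fix≢low : ∀ c d → Fix.enum c ≢ Low.enum d
    fix≢low c d eq = <-irrefl (sym (subst (λ x → σ x ≡ x) eq (fix-fixed c))) (low-lower d)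

    fix≢σlow : ∀ c d → Fix.enum c ≢ σ (Low.enum d)
    fix≢σlow c d eq =
      fix≢low c d (sym (trans (trans (sym (σ-involutive _)) (cong σ (sym eq))) (fix-fixed c)))

    low≢σlow : ∀ c d → Low.enum c ≢ σ (Low.enum d)
    low≢σlow c d eq = <-asym
      (subst (Low.enum c Fin.<_) (trans (cong σ eq) (σ-involutive _)) (low-lower c))
      (subst (Low.enum d Fin.<_) (sym eq) (low-lower d))

    -- A two-element orbit {x, σ x} is represented by its smaller element.
    ψ : Orbits (count fixed?) (count lower?) → Fin m
    ψ (inj₁ c)        = Fix.enum c
    ψ (inj₂ (inj₁ c)) = Low.enum c
    ψ (inj₂ (inj₂ c)) = σ (Low.enum c)

    ψ-swap : ∀ o → σ (ψ o) ≡ ψ (map₂ swap o)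
    ψ-swap (inj₁ c)        = fix-fixed c
    ψ-swap (inj₂ (inj₁ c)) = refl
    ψ-swap (inj₂ (inj₂ c)) = σ-involutive (Low.enum c)

    ψ-injective : Injective _≡_ _≡_ ψ
    ψ-injective {inj₁ c}        {inj₁ d}        eq = cong inj₁ (Fix.injective eq)
    ψ-injective {inj₂ (inj₁ c)} {inj₂ (inj₁ d)} eq = cong (inj₂ ∘ inj₁) (Low.injective eq)
    ψ-injective {inj₂ (inj₂ c)} {inj₂ (inj₂ d)} eq = cong (inj₂ ∘ inj₂)
      (Low.injective (trans (sym (σ-involutive _)) (trans (cong σ eq) (σ-involutive _))))
    ψ-injective {inj₁ c}        {inj₂ (inj₁ d)} eq = contradiction eq (fix≢low c d)
    ψ-injective {inj₁ c}        {inj₂ (inj₂ d)} eq = contradiction eq (fix≢σlow c d)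
    ψ-injective {inj₂ (inj₁ c)} {inj₁ d}        eq = contradiction (sym eq) (fix≢low d c)
    ψ-injective {inj₂ (inj₂ c)} {inj₁ d}        eq = contradiction (sym eq) (fix≢σlow d c)
    ψ-injective {inj₂ (inj₁ c)} {inj₂ (inj₂ d)} eq = contradiction eq (low≢σlow c d)
    ψ-injective {inj₂ (inj₂ c)} {inj₂ (inj₁ d)} eq = contradiction (sym eq) (low≢σlow d c)

    ψ-surjective : StrictlySurjective _≡_ ψ
    ψ-surjective x with <-cmp x (σ x)
    ... | tri< x<σx _ _
      with c , eq ← Low.complete x (fromWitness≡ (x <? σ x) x<σx)
      = inj₂ (inj₁ c) , eq
    ... | tri≈ _ x≡σx _
      with c , eq ← Fix.complete x (fromWitness≡ (σ x ≟ x) (sym x≡σx))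
      = inj₁ c , eq
    ... | tri> _ _ σx<x
      with c , eq ← Low.complete (σ x) (fromWitness≡ (σ x <? σ (σ x))
                                      (subst (σ x Fin.<_) (sym (σ-involutive x)) σx<x))
      = inj₂ (inj₂ c) , trans (cong σ eq) (σ-involutive x)

  involutionOrbits : ∃₂ λ a b → Σ (Orbits a b ⤖ Fin m) λ ψ →
    ∀ o → σ (Bijection.to ψ o) ≡ Bijection.to ψ (map₂ swap o)
  involutionOrbits =
    _ , _ , mk⤖ (ψ-injective , strictlySurjective⇒surjective ψ-surjective) , ψ-swap

IsBlowUp : Graph v → ((Fin m × Fin n) ↔ Fin v) → (Fin m → Fin m → Bool) → Set
IsBlowUp G Φ A = ∀ p q → adj G (Inverse.to Φ p) (Inverse.to Φ q) ≡ A (proj₁ p) (proj₁ q)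

module BlowUp {G : Graph v} {Φ : (Fin m × Fin n) ↔ Fin v} {A : Fin m → Fin m → Bool}
              (blowUp : IsBlowUp G Φ A) where

  open Inverse Φ

  adj-from : ∀ p x → adj G (to p) x ≡ A (proj₁ p) (proj₁ (from x))
  adj-from p x = trans (cong (adj G (to p)) (sym (strictlyInverseˡ x))) (blowUp p (from x))

  degree-blowUp : ∀ p → degree G (to p) ≡ n * count (A (proj₁ p))
  degree-blowUp p = trans (count-cong (adj-from p)) (count-proj₁ Φ (A (proj₁ p)))

  common-blowUp : ∀ p q →
    common G (to p) (to q) ≡ n * count (λ j → A (proj₁ p) j ∧ A (proj₁ q) j)
  common-blowUp p q = trans (count-cong (λ x → cong₂ _∧_ (adj-from p x) (adj-from q x)))
    (count-proj₁ Φ (λ j → A (proj₁ p) j ∧ A (proj₁ q) j))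

  designGraph : IsoTo G (Fin m × Fin n) (designGraphAdj n A (Bijection.to (⤖-id (Fin m))))
  designGraph = ↔⇒⤖ Φ , blowUp

_≟ₒ_ : ∀ {a b} → DecidableEquality (Orbits a b)
_≟ₒ_ = ≡-dec _≟_ (≡-dec _≟_ _≟_)

module _ {a b n : ℕ} where

  orbit : DUVertex a b n → Orbits a b
  orbit (inj₁ (c , _))       = inj₁ c
  orbit (inj₂ (c , inj₁ _)) = inj₂ (inj₁ c)
  orbit (inj₂ (c , inj₂ _)) = inj₂ (inj₂ c)

  position : DUVertex a b n → Fin n
  position (inj₁ (_ , p))       = p
  position (inj₂ (_ , inj₁ p)) = p
  position (inj₂ (_ , inj₂ p)) = p

  vertex : Orbits a b × Fin n → DUVertex a b n
  vertex (inj₁ c        , p) = inj₁ (c , p)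
  vertex (inj₂ (inj₁ c) , p) = inj₂ (c , inj₁ p)
  vertex (inj₂ (inj₂ c) , p) = inj₂ (c , inj₂ p)

  DUVertex↔ : DUVertex a b n ↔ (Orbits a b × Fin n)
  DUVertex↔ = mk↔ₛ′ < orbit , position > vertex
    (λ { (inj₁ _ , _) → refl ; (inj₂ (inj₁ _) , _) → refl ; (inj₂ (inj₂ _) , _) → refl })
    (λ { (inj₁ _) → refl ; (inj₂ (_ , inj₁ _)) → refl ; (inj₂ (_ , inj₂ _)) → refl })

  -- Phrased with does: ⌊_⌋ does not compute through the map′ inside ≡-dec.
  duAdj-orbit : ∀ u w → duAdj u w ≡ does (map₂ swap (orbit u) ≟ₒ orbit w)
  duAdj-orbit (inj₁ (c , _))      (inj₁ (d , _))      = isYes≗does (c ≟ d)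
  duAdj-orbit (inj₁ _)            (inj₂ (_ , inj₁ _)) = refl
  duAdj-orbit (inj₁ _)            (inj₂ (_ , inj₂ _)) = refl
  duAdj-orbit (inj₂ (_ , inj₁ _)) (inj₁ _)            = refl
  duAdj-orbit (inj₂ (_ , inj₁ _)) (inj₂ (_ , inj₁ _)) = refl
  duAdj-orbit (inj₂ (c , inj₁ _)) (inj₂ (d , inj₂ _)) = isYes≗does (c ≟ d)
  duAdj-orbit (inj₂ (_ , inj₂ _)) (inj₁ _)            = refl
  duAdj-orbit (inj₂ (c , inj₂ _)) (inj₂ (d , inj₁ _)) = isYes≗does (c ≟ d)
  duAdj-orbit (inj₂ (_ , inj₂ _)) (inj₂ (_ , inj₂ _)) = refl

involutionBlowUp⇒disjointUnion :
  {G : Graph v} {Φ : (Fin m × Fin n) ↔ Fin v} {A : Fin m → Fin m → Bool} → IsBlowUp G Φ A →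
  (σ : Fin m → Fin m) → (∀ i → σ (σ i) ≡ i) → (∀ i j → A i j ≡ ⌊ σ i ≟ j ⌋) →
  DisjointUnionKtildeKnn G n
involutionBlowUp⇒disjointUnion {G = G} {Φ} {A} blowUp σ σ-involutive A≡σ
  with a , b , ψ , ψ-swap ← involutionOrbits σ σ-involutive
  = a , b , T , T-adj
  where
  module ψ = Bijection ψ

  σψ≡ψ⇔ : ∀ o o′ → σ (ψ.to o) ≡ ψ.to o′ ⇔ map₂ swap o ≡ o′
  σψ≡ψ⇔ o o′ = mk⇔ (λ eq → ψ.injective (trans (sym (ψ-swap o)) eq))
                   (λ eq → trans (ψ-swap o) (cong ψ.to eq))

  T : DUVertex a b _ ⤖ Fin _
  T = ↔⇒⤖ Φ ⤖-∘ ((ψ ×-⤖ ⤖-id _) ⤖-∘ ↔⇒⤖ DUVertex↔)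

  T-adj : ∀ u w → adj G (Bijection.to T u) (Bijection.to T w) ≡ duAdj u w
  T-adj u w = begin
    adj G (Bijection.to T u) (Bijection.to T w)
      ≡⟨ blowUp (i , position u) (j , position w) ⟩
    A i j
      ≡⟨ A≡σ i j ⟩
    ⌊ σ i ≟ j ⌋
      ≡⟨ isYes≗does (σ i ≟ j) ⟩
    does (σ i ≟ j)
      ≡⟨ does-⇔ (σψ≡ψ⇔ o o′) (σ i ≟ j) (map₂ swap o ≟ₒ o′) ⟩
    does (map₂ swap o ≟ₒ o′)
      ≡⟨ duAdj-orbit u w ⟨
    duAdj u w
      ∎
    where
    o o′ : Orbits a b
    o  = orbit u
    o′ = orbit w
    i j : Fin _
    i = ψ.to o
    j = ψ.to o′

module SymmetricDesign {B : Fin m → Fin m → Bool} {l₁ l₂ : ℕ}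
                       (design : IsSymmetricDesign m l₁ l₂ B) where

  private
    blockSize = proj₁ design
    meet      = proj₂ design

  bounds : ∀ {b c} → b ≢ c → l₁ ≢ l₂ → l₂ < l₁ × l₁ < m
  bounds {b} {c} b≢c l₁≢l₂ =
    ≤∧≢⇒< l₂≤l₁ (l₁≢l₂ ∘ sym) , ≤∧≢⇒< l₁≤m l₁≢m
    where
    l₂≤l₁ : l₂ ≤ l₁
    l₂≤l₁ = subst₂ _≤_ (meet b c b≢c) (blockSize b) (count-∧≤ (B b) (B c))
    l₁≤m : l₁ ≤ m
    l₁≤m = subst (_≤ m) (blockSize b) (count-≤ (B b))
    l₁≢m : l₁ ≢ m
    l₁≢m l₁≡m = l₁≢l₂ (begin
      l₁                         ≡⟨ blockSize c ⟨
      count (B c)                ≡⟨ count-cong (λ i → cong (_∧ B c i) (b-full i)) ⟨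
      count (λ i → B b i ∧ B c i) ≡⟨ meet b c b≢c ⟩
      l₂                         ∎)
      where
      b-full : ∀ i → B b i ≡ true
      b-full = count≡n⇒true (B b) (trans (blockSize b) l₁≡m)

  module Disjoint (l₂≡0 : l₂ ≡ 0) (l₁≢0 : l₁ ≢ 0) (B-sym : ∀ i j → B j i ≡ B i j)
    where

    σ : Fin m → Fin m
    σ i = proj₁ (count≢0⇒∃ (B i) (l₁≢0 ∘ trans (sym (blockSize i))))

    B-σ : ∀ i → B i (σ i) ≡ true
    B-σ i = proj₂ (count≢0⇒∃ (B i) (l₁≢0 ∘ trans (sym (blockSize i))))

    column-unique : ∀ {c d j} → B c j ≡ true → B d j ≡ true → c ≡ d
    column-unique {c} {d} {j} Bcj Bdj with c ≟ d
    ... | yes c≡d = c≡d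
    ... | no  c≢d = contradiction
      (trans (sym (cong₂ _∧_ Bcj Bdj)) (count≡0⇒false _ (trans (meet c d c≢d) l₂≡0) j)) λ ()

    row-unique : ∀ {i j} → B i j ≡ true → j ≡ σ i
    row-unique {i} {j} Bij = column-unique (trans (B-sym i j) Bij) (trans (B-sym i (σ i)) (B-σ i))

    σ-involutive : ∀ i → σ (σ i) ≡ i
    σ-involutive i = sym (row-unique (trans (B-sym i (σ i)) (B-σ i)))

    B≡σ : ∀ i j → B i j ≡ ⌊ σ i ≟ j ⌋
    B≡σ i j = ⇔true⇒≡ (fromWitness≡ (σ i ≟ j) ∘ sym ∘ row-unique) B-σ-≟
      where
      B-σ-≟ : ⌊ σ i ≟ j ⌋ ≡ true → B i j ≡ true
      B-σ-≟ σi≡j = subst (λ k → B i k ≡ true) (toWitness≡ (σ i ≟ j) σi≡j) (B-σ i)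

module LDDG {v k λ₁ λ₂ m n} {G : Graph v} (L : IsLDDG G k λ₁ λ₂ m n) where

  open IsLDDG L

  classBijection : Σ ((Fin m × Fin n) ↔ Fin v) λ Φ → ∀ p → cls (Inverse.to Φ p) ≡ proj₁ p
  classBijection = fibreBijection cls (λ c → subst (Enumeration _) (clsSize c) (enumerate _))

  Φ : (Fin m × Fin n) ↔ Fin v
  Φ = proj₁ classBijection

  cls-Φ : ∀ p → cls (Inverse.to Φ p) ≡ proj₁ p
  cls-Φ = proj₂ classBijection

  Φ-injective : Injective _≡_ _≡_ (Inverse.to Φ)
  Φ-injective = Bijection.injective (↔⇒⤖ Φ)

  λ₁≤k : ∀ {x y} → x ≢ y → cls x ≡ cls y → λ₁ ≤ k
  λ₁≤k {x} {y} x≢y same =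
    subst₂ _≤_ (sameClass x y x≢y same) (regular x) (count-∧≤ (adj G x) (adj G y))

  sameNeighbourhood : λ₁ ≡ k → ∀ {x y} → cls x ≡ cls y → ∀ z → adj G x z ≡ adj G y z
  sameNeighbourhood λ₁≡k {x} {y} same z with x ≟ y
  ... | yes refl = refl
  ... | no  x≢y  = ⇔true⇒≡ (count-∧≡⇒⊆ (adj G x) (adj G y) (saturated x≢y same))
                           (count-∧≡⇒⊆ (adj G y) (adj G x) (saturated (x≢y ∘ sym) (sym same)))
    where
    saturated : ∀ {x y} → x ≢ y → cls x ≡ cls y → common G x y ≡ degree G x
    saturated {x} {y} x≢y same = trans (sameClass x y x≢y same) (trans λ₁≡k (sym (regular x)))

  sameAdjacency : λ₁ ≡ k → ∀ {x x′ y y′} → cls x ≡ cls x′ → cls y ≡ cls y′ →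
    adj G x y ≡ adj G x′ y′
  sameAdjacency λ₁≡k {x} {x′} {y} {y′} x~x′ y~y′ = begin
    adj G x y   ≡⟨ sameNeighbourhood λ₁≡k x~x′ y ⟩
    adj G x′ y  ≡⟨ Graph.sym G x′ y ⟩
    adj G y x′  ≡⟨ sameNeighbourhood λ₁≡k y~y′ x′ ⟩
    adj G y′ x′ ≡⟨ Graph.sym G y′ x′ ⟩
    adj G x′ y′ ∎

module Saturated {v k λ₁ λ₂ m n} {G : Graph v}
                 (L : IsLDDG G k λ₁ λ₂ m (suc n)) (λ₁≡k : λ₁ ≡ k) where

  open IsLDDG L
  open LDDG L

  A : Fin m → Fin m → Bool
  A i j = adj G (Inverse.to Φ (i , zero)) (Inverse.to Φ (j , zero))

  A-sym : ∀ i j → A j i ≡ A i j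
  A-sym i j = Graph.sym G _ _

  blowUp : IsBlowUp G Φ A
  blowUp p q = sameAdjacency λ₁≡k (sameClassAsRep p) (sameClassAsRep q)
    where
    sameClassAsRep : ∀ p → cls (Inverse.to Φ p) ≡ cls (Inverse.to Φ (proj₁ p , zero))
    sameClassAsRep p = trans (cls-Φ p) (sym (cls-Φ (proj₁ p , zero)))

  open BlowUp {G = G} {Φ = Φ} blowUp

  k≡rowSize : ∀ i → k ≡ suc n * count (A i)
  k≡rowSize i = trans (sym (regular _)) (degree-blowUp (i , zero))

  λ₂≡rowMeet : ∀ {i j} → i ≢ j → λ₂ ≡ suc n * count (λ l → A i l ∧ A j l)
  λ₂≡rowMeet {i} {j} i≢j =
    trans (sym (diffClass _ _ (i≢j ∘ cls-Φ-≡))) (common-blowUp (i , zero) (j , zero))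
    where
    cls-Φ-≡ : cls (Inverse.to Φ (i , zero)) ≡ cls (Inverse.to Φ (j , zero)) → i ≡ j
    cls-Φ-≡ eq = trans (sym (cls-Φ (i , zero))) (trans eq (cls-Φ (j , zero)))

  module _ {i₀ i₁ : Fin m} (i₀≢i₁ : i₀ ≢ i₁) where

    l₁ l₂ : ℕ
    l₁ = count (A i₀)
    l₂ = count (λ j → A i₀ j ∧ A i₁ j)

    A-design : IsSymmetricDesign m l₁ l₂ A
    A-design = rowSize , rowMeet
      where
      rowSize : ∀ i → count (A i) ≡ l₁
      rowSize i = *-cancelˡ-≡ _ _ (suc n) (trans (sym (k≡rowSize i)) (k≡rowSize i₀))
      rowMeet : ∀ i j → i ≢ j → count (λ l → A i l ∧ A j l) ≡ l₂
      rowMeet i j i≢j =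
        *-cancelˡ-≡ _ _ (suc n) (trans (sym (λ₂≡rowMeet i≢j)) (λ₂≡rowMeet i₀≢i₁))

    l₁≢l₂ : λ₁ ≢ λ₂ → l₁ ≢ l₂
    l₁≢l₂ λ₁≢λ₂ l₁≡l₂ = λ₁≢λ₂ (begin
      λ₁         ≡⟨ λ₁≡k ⟩
      k          ≡⟨ k≡rowSize i₀ ⟩
      suc n * l₁ ≡⟨ cong (suc n *_) l₁≡l₂ ⟩
      suc n * l₂ ≡⟨ λ₂≡rowMeet i₀≢i₁ ⟨
      λ₂         ∎)

    classification : λ₁ ≢ λ₂ → 2 ≤ suc n →
      FromSymmetricDesign G m (suc n) ⊎ DisjointUnionKtildeKnn G (suc n)
    classification λ₁≢λ₂ 2≤n with l₂ ≟ℕ 0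
    ... | no l₂≢0 = inj₁ (l₁ , l₂ , A , ⤖-id _ , 3≤m , 0<l₂ , l₂<l₁ , l₁<m , 2≤n ,
                          A-design , A-sym , designGraph)
      where
      0<l₂ : 0 < l₂
      0<l₂ = n≢0⇒n>0 l₂≢0
      l₂<l₁ : l₂ < l₁
      l₂<l₁ = proj₁ (SymmetricDesign.bounds A-design i₀≢i₁ (l₁≢l₂ λ₁≢λ₂))
      l₁<m : l₁ < m
      l₁<m = proj₂ (SymmetricDesign.bounds A-design i₀≢i₁ (l₁≢l₂ λ₁≢λ₂))
      3≤m : 3 ≤ m
      3≤m = ≤-trans (s≤s (≤-trans (s≤s 0<l₂) l₂<l₁)) l₁<m
    ... | yes l₂≡0 =
      inj₂ (involutionBlowUp⇒disjointUnion {G = G} {Φ = Φ} blowUp σ σ-involutive B≡σ)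
      where
      open SymmetricDesign.Disjoint A-design l₂≡0
        (λ l₁≡0 → l₁≢l₂ λ₁≢λ₂ (trans l₁≡0 (sym l₂≡0))) A-sym

proposition3p4 : ∀ {v k λ₁ λ₂ m n : ℕ} (G : Graph v) →
    IsLDDG G k λ₁ λ₂ m n → IsProper λ₁ λ₂ m n →
    (0 ≤ λ₁ × λ₁ ≤ k) ×
    (λ₁ ≡ k → FromSymmetricDesign G m n ⊎ DisjointUnionKtildeKnn G n)
proposition3p4 G L (s≤s (s≤s _) , 2≤n@(s≤s (s≤s _)) , λ₁≢λ₂) =
  (z≤n , λ₁≤k x≢y (trans (cls-Φ (zero , zero)) (sym (cls-Φ (zero , suc zero))))) ,
  λ λ₁≡k → Saturated.classification L λ₁≡k {zero} {suc zero} (λ ()) λ₁≢λ₂ 2≤n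
  where
  open LDDG L
  x≢y : Inverse.to Φ (zero , zero) ≢ Inverse.to Φ (zero , suc zero)
  x≢y = (λ ()) ∘ Φ-injective
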